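{- Let $G$ be a finite simple non-bipartite graph and let $x,y$ be distinct vertices of $G$ such that $G+xy$ is $2$-connected. Then there exist a path of odd length and a path of even length between $x$ and $y$ in $G$.
   Context: $G+xy$ denotes the graph obtained from $G$ by adding the edge $xy$ (so $E(G+xy)=E(G)\cup\{xy\}$). The length of a path is its number of edges. -}

module Defs where

open import Data.Nat using (ℕ; zero; suc; _≤_)
open import Data.Fin using (Fin; zero; suc; fromℕ; inject₁)
open import Data.Product using (Σ; ∃; _×_; _,_)
open import Data.Sum using (_⊎_)
open import Data.Bool using (Bool)
open import Relation.Nullary using (¬_; Dec)
open import Relation.Binary.PropositionalEquality using (_≡_; _≢_)
open import Function.Definitions using (Injective)

record SimpleGraph (n : ℕ) : Set₁ where
  field
    Adj        : Fin n → Fin n → Set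
    adj-sym    : ∀ {u v} → Adj u v → Adj v u
    adj-irrefl : ∀ {u} → ¬ Adj u u
    dec        : ∀ u v → Dec (Adj u v)
open SimpleGraph public

_+edge_ : ∀ {n} → SimpleGraph n → (Σ (Fin n × Fin n) λ { (x , y) → x ≢ y }) → SimpleGraph n
_+edge_ {n} G ((x , y) , x≢y) = record
  { Adj        = A
  ; adj-sym    = sy
  ; adj-irrefl = ir
  ; dec        = de
  }
  where
  open import Data.Sum using (inj₁; inj₂)
  open import Data.Fin using (_≟_)
  open import Relation.Nullary using (yes; no)
  open import Relation.Binary.PropositionalEquality using (refl; trans; sym)
  A : Fin n → Fin n → Set
  A u v = Adj G u v ⊎ ((u ≡ x × v ≡ y) ⊎ (u ≡ y × v ≡ x))
  sy : ∀ {u v} → A u v → A v u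
  sy (inj₁ a) = inj₁ (adj-sym G a)
  sy (inj₂ (inj₁ (p , q))) = inj₂ (inj₂ (q , p))
  sy (inj₂ (inj₂ (p , q))) = inj₂ (inj₁ (q , p))
  ir : ∀ {u} → ¬ A u u
  ir (inj₁ a) = adj-irrefl G a
  ir (inj₂ (inj₁ (p , q))) = x≢y (trans (sym p) q)
  ir (inj₂ (inj₂ (p , q))) = x≢y (trans (sym q) p)
  de : ∀ u v → Dec (A u v)
  de u v with dec G u v | u ≟ x | v ≟ y | u ≟ y | v ≟ x
  ... | yes a | _ | _ | _ | _ = yes (inj₁ a)
  ... | no _ | yes p | yes q | _ | _ = yes (inj₂ (inj₁ (p , q)))
  ... | no _ | _ | _ | yes p | yes q = yes (inj₂ (inj₂ (p , q)))
  ... | no ¬a | yes _ | no ¬q | no ¬p | _ = no λ { (inj₁ a) → ¬a a ; (inj₂ (inj₁ (_ , q))) → ¬q q ; (inj₂ (inj₂ (p , _))) → ¬p p }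
  ... | no ¬a | yes _ | no ¬q | yes _ | no ¬q' = no λ { (inj₁ a) → ¬a a ; (inj₂ (inj₁ (_ , q))) → ¬q q ; (inj₂ (inj₂ (_ , q))) → ¬q' q }
  ... | no ¬a | no ¬p | _ | no ¬p' | _ = no λ { (inj₁ a) → ¬a a ; (inj₂ (inj₁ (p , _))) → ¬p p ; (inj₂ (inj₂ (p , _))) → ¬p' p }
  ... | no ¬a | no ¬p | _ | yes _ | no ¬q' = no λ { (inj₁ a) → ¬a a ; (inj₂ (inj₁ (p , _))) → ¬p p ; (inj₂ (inj₂ (_ , q))) → ¬q' q }

record Path {n : ℕ} (G : SimpleGraph n) (x y : Fin n) (k : ℕ) : Set where
  field
    vtx   : Fin (suc k) → Fin n
    inj   : Injective _≡_ _≡_ vtx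
    start : vtx zero ≡ x
    end   : vtx (fromℕ k) ≡ y
    step  : ∀ (i : Fin k) → Adj G (vtx (inject₁ i)) (vtx (suc i))
open Path public

Connected : ∀ {n} → SimpleGraph n → Set
Connected {n} G = ∀ (u w : Fin n) → ∃ λ k → Path G u w k

ConnectedWithout : ∀ {n} → SimpleGraph n → Fin n → Set
ConnectedWithout {n} G v =
  ∀ (u w : Fin n) → u ≢ v → w ≢ v →
  ∃ λ k → Σ (Path G u w k) λ p → ∀ i → vtx p i ≢ v

TwoConnected : ∀ {n} → SimpleGraph n → Set
TwoConnected {n} G = (3 ≤ n) × Connected G × (∀ v → ConnectedWithout G v)

Bipartite : ∀ {n} → SimpleGraph n → Set
Bipartite {n} G = Σ (Fin n → Bool) λ c → ∀ u v → Adj G u v → c u ≢ c v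

-- Fix an x–y path R in G (through a third vertex, using that G + xy − x and G + xy − y are connected);
-- it suffices to find an x–y path whose parity differs from that of R. Call a path with both ends on R
-- matched when its parity is that of the segment of R between its ends. Such a path splits at its visits
-- to R into ears, matchedness is additive along the splitting, and an unmatched ear can replace its
-- segment of R, giving the required path. Hence two paths with the same ends on R and different
-- parities already give it.
-- Since G is not bipartite it has an odd cycle C; take a path T from C to R meeting C only at its start c.
-- As G + xy − c is connected there is a path Q avoiding c from C to R ∪ T meeting each only at an end, and
-- it does not use xy because x and y lie on R. If Q ends on R outside T, the two arcs of C from c to the
-- start of Q give two paths T⁻¹ · arc · Q of different parities. Otherwise Q ends on T, and one of the
-- arcs closes up with Q and the initial segment of T to an odd cycle with the shorter tail the rest of T;
-- induct on the length of T.
module Submission where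

open import Data.Bool as Bool using (Bool; true; false)
open import Data.Empty using (⊥-elim)
open import Data.Fin using (Fin; zero; suc; fromℕ; inject₁; _≟_)
open import Data.Fin.Properties using (any?)
open import Data.List as List using (List; []; _∷_; _++_; _ʳ++_)
open import Data.List.Membership.Propositional using (_∈_; _∉_; lose)
open import Data.List.Membership.Propositional.Properties using (∈-++⁺ˡ; ∈-++⁺ʳ; ∈-++⁻; ∈-lookup; ∈-tabulate⁻)
import Data.List.Properties as List
open import Data.List.Relation.Binary.Disjoint.Propositional using (Disjoint)
open import Data.List.Relation.Binary.Permutation.Propositional using (_↭_; ↭-sym; ↭⇒↭ₛ)
open import Data.List.Relation.Binary.Permutation.Propositional.Properties using (++-comm; ↭-reverse)
import Data.List.Relation.Binary.Permutation.Setoid.Properties as Permₚ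
open import Data.List.Relation.Binary.Subset.Propositional using (_⊆_)
open import Data.List.Relation.Unary.All as All using (All)
import Data.List.Relation.Unary.All.Properties as Allₚ
open import Data.List.Relation.Unary.AllPairs using ([]; _∷_)
open import Data.List.Relation.Unary.Any as Any using (Any; here; there)
import Data.List.Relation.Unary.Any.Properties as Anyₚ
open import Data.List.Relation.Unary.Unique.Propositional using (Unique)
import Data.List.Relation.Unary.Unique.Propositional.Properties as Uniqueₚ
open import Data.Nat using (ℕ; zero; suc; _+_; _*_; _<_; _≤_; s≤s; z≤n)
open import Data.Nat.Base using (parity)
open import Data.Nat.Divisibility using (_∣_; divides)
open import Data.Nat.Induction using (<-wellFounded)
open import Data.Nat.Properties using (+-comm; suc-injective; m<n+m)
open import Data.Parity.Base as ℙ using (Parity; 0ℙ; 1ℙ)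
import Data.Parity.Properties as ℙ
open import Data.Product using (Σ; ∃; ∃₂; _×_; _,_; proj₁)
open import Data.Sum using (_⊎_; inj₁; inj₂; [_,_]′; map₂; swap)
open import Induction.WellFounded using (Acc; acc)
open import Relation.Binary.Construct.Closure.ReflexiveTransitive using (Star; ε; _◅_; _◅◅_; revApp; reverse)
open import Relation.Binary.Construct.Closure.ReflexiveTransitive.Properties using (◅◅-assoc)
open import Relation.Binary.Definitions using (Sym; DecidableEquality)
open import Relation.Binary.PropositionalEquality
open import Relation.Nullary using (¬_; Dec; yes; no)
open import Relation.Nullary.Decidable using (_×-dec_; _⊎-dec_)
open import Relation.Unary using (Decidable)

open import Defs

module _ {A : Set} where

  Unique-∷ : ∀ {x} {xs : List A} → x ∉ xs → Unique xs → Unique (x ∷ xs)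
  Unique-∷ {xs = xs} x∉ u = Allₚ.¬Any⇒All¬ xs x∉ ∷ u

  Unique-++⁻ˡ : ∀ xs {ys : List A} → Unique (xs ++ ys) → Unique xs
  Unique-++⁻ˡ []       _          = []
  Unique-++⁻ˡ (x ∷ xs) (x∉ ∷ u) = Allₚ.++⁻ˡ xs x∉ ∷ Unique-++⁻ˡ xs u

  Unique-++⁻ʳ : ∀ xs {ys : List A} → Unique (xs ++ ys) → Unique ys
  Unique-++⁻ʳ []       u       = u
  Unique-++⁻ʳ (x ∷ xs) (_ ∷ u) = Unique-++⁻ʳ xs u

  Unique-++⁻-disjoint : ∀ xs {ys : List A} → Unique (xs ++ ys) → Disjoint xs ys
  Unique-++⁻-disjoint (x ∷ xs) (x∉ ∷ u) (here refl , v∈ys) = All.lookup (Allₚ.++⁻ʳ xs x∉) v∈ys refl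
  Unique-++⁻-disjoint (x ∷ xs) (_ ∷ u)  (there v∈xs , v∈ys) = Unique-++⁻-disjoint xs u (v∈xs , v∈ys)

  Unique-lookup-injective : ∀ {xs : List A} → Unique xs → ∀ {i j} → List.lookup xs i ≡ List.lookup xs j → i ≡ j
  Unique-lookup-injective {_ ∷ _} _         {zero}  {zero}  _  = refl
  Unique-lookup-injective {_ ∷ _} (x∉ ∷ _)  {zero}  {suc j} eq = ⊥-elim (All.lookup x∉ (∈-lookup j) eq)
  Unique-lookup-injective {_ ∷ _} (x∉ ∷ _)  {suc i} {zero}  eq = ⊥-elim (All.lookup x∉ (∈-lookup i) (sym eq))
  Unique-lookup-injective {_ ∷ _} (_ ∷ u)   {suc i} {suc j} eq = cong suc (Unique-lookup-injective u eq)

  Unique-resp-↭ : ∀ {xs ys : List A} → xs ↭ ys → Unique xs → Unique ys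
  Unique-resp-↭ p = Permₚ.Unique-resp-↭ (setoid A) (↭⇒↭ₛ p)

p+[p+q]≡q : ∀ p q → p ℙ.+ (p ℙ.+ q) ≡ q
p+[p+q]≡q p q = trans (sym (ℙ.+-assoc p p q)) (cong (ℙ._+ q) (ℙ.p+p≡0ℙ p))

[p+q]+[q+r]≡p+r : ∀ p q r → (p ℙ.+ q) ℙ.+ (q ℙ.+ r) ≡ p ℙ.+ r
[p+q]+[q+r]≡p+r p q r = trans (ℙ.+-assoc p q (q ℙ.+ r)) (cong (p ℙ.+_) (p+[p+q]≡q q r))

p+q≡1ℙ⇒p≢q : ∀ {p q} → p ℙ.+ q ≡ 1ℙ → p ≢ q
p+q≡1ℙ⇒p≢q {p} p+q≡1 refl with () ← trans (sym (ℙ.p+p≡0ℙ p)) p+q≡1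

p≢q⇒r+[p+s]≢r+[q+s] : ∀ {p q} r s → p ≢ q → r ℙ.+ (p ℙ.+ s) ≢ r ℙ.+ (q ℙ.+ s)
p≢q⇒r+[p+s]≢r+[q+s] {p} {q} r s p≢q eq = p≢q (ℙ.+-cancelʳ-≡ s p q (ℙ.+-cancelˡ-≡ r _ _ eq))

p≢q⇒p≡1ℙ⊎q≡1ℙ : ∀ {p q} → p ≢ q → p ≡ 1ℙ ⊎ q ≡ 1ℙ
p≢q⇒p≡1ℙ⊎q≡1ℙ {1ℙ} _   = inj₁ refl
p≢q⇒p≡1ℙ⊎q≡1ℙ {0ℙ} {1ℙ} _   = inj₂ refl
p≢q⇒p≡1ℙ⊎q≡1ℙ {0ℙ} {0ℙ} 0≢0 = ⊥-elim (0≢0 refl)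

module Walks {V : Set} {E : V → V → Set} where

  private
    W = Star E
    variable
      a b c d u v : V

  targets : W a b → List V
  targets ε                 = []
  targets (_◅_ {j = b} _ w) = b ∷ targets w

  vertices : W a b → List V
  vertices {a} w = a ∷ targets w

  length : W a b → ℕ
  length w = List.length (targets w)

  -- IsCycle also admits the degenerate closed walks ε and u → v → u, but none of odd length.
  IsPath : W a b → Set
  IsPath w = Unique (vertices w)

  IsCycle : W a a → Set
  IsCycle w = Unique (targets w)

  targets-◅◅ : (p : W a b) (q : W b c) → targets (p ◅◅ q) ≡ targets p ++ targets q
  targets-◅◅ ε       q = refl
  targets-◅◅ (e ◅ p) q = cong (_ ∷_) (targets-◅◅ p q)

  vertices-◅◅ : (p : W a b) (q : W b c) → vertices (p ◅◅ q) ≡ vertices p ++ targets q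
  vertices-◅◅ p q = cong (_ ∷_) (targets-◅◅ p q)

  length-◅◅ : (p : W a b) (q : W b c) → length (p ◅◅ q) ≡ length p + length q
  length-◅◅ p q = trans (cong List.length (targets-◅◅ p q)) (List.length-++ (targets p))

  parityOf : W a b → Parity
  parityOf w = parity (length w)

  parityOf-◅ : (e : E a b) (w : W b c) → parityOf (e ◅ w) ≡ 1ℙ ℙ.+ parityOf w
  parityOf-◅ e w = ℙ.+-homo-+ 1 (length w)

  parityOf-◅◅ : (p : W a b) (q : W b c) → parityOf (p ◅◅ q) ≡ parityOf p ℙ.+ parityOf q
  parityOf-◅◅ p q = trans (cong parity (length-◅◅ p q)) (ℙ.+-homo-+ (length p) (length q))

  parityOf-◅◅³ : (p : W a b) (q : W b c) (r : W c d) →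
                 parityOf (p ◅◅ q ◅◅ r) ≡ parityOf p ℙ.+ (parityOf q ℙ.+ parityOf r)
  parityOf-◅◅³ p q r = trans (parityOf-◅◅ p (q ◅◅ r)) (cong (parityOf p ℙ.+_) (parityOf-◅◅ q r))

  end∈vertices : (w : W a b) → b ∈ vertices w
  end∈vertices ε       = here refl
  end∈vertices (e ◅ w) = there (end∈vertices w)

  targets-◅◅⁺ˡ : (p : W a b) (q : W b c) → targets p ⊆ targets (p ◅◅ q)
  targets-◅◅⁺ˡ p q {v} v∈p = subst (v ∈_) (sym (targets-◅◅ p q)) (∈-++⁺ˡ v∈p)

  ∈-◅◅⁺ˡ : (p : W a b) (q : W b c) → vertices p ⊆ vertices (p ◅◅ q)
  ∈-◅◅⁺ˡ p q {v} v∈p = subst (v ∈_) (sym (vertices-◅◅ p q)) (∈-++⁺ˡ v∈p)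

  ∈-◅◅⁺ʳ : (p : W a b) (q : W b c) → vertices q ⊆ vertices (p ◅◅ q)
  ∈-◅◅⁺ʳ p q (here refl) = ∈-◅◅⁺ˡ p q (end∈vertices p)
  ∈-◅◅⁺ʳ p q {v} (there v∈q) = subst (v ∈_) (sym (vertices-◅◅ p q)) (∈-++⁺ʳ (vertices p) v∈q)

  ∈-◅◅⁻ : (p : W a b) (q : W b c) → v ∈ vertices (p ◅◅ q) → v ∈ vertices p ⊎ v ∈ vertices q
  ∈-◅◅⁻ {v = v} p q v∈pq with ∈-++⁻ (vertices p) (subst (v ∈_) (vertices-◅◅ p q) v∈pq)
  ... | inj₁ v∈p = inj₁ v∈p
  ... | inj₂ v∈q = inj₂ (there v∈q)

  split : (w : W a b) → u ∈ vertices w → ∃₂ λ (p : W a u) (q : W u b) → p ◅◅ q ≡ w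
  split ε       (here refl) = ε , ε , refl
  split (e ◅ w) (here refl) = ε , e ◅ w , refl
  split (e ◅ w) (there u∈w) with split w u∈w
  ... | p , q , refl = e ◅ p , q , refl

  IsPath-◅◅⁻ˡ : (p : W a b) (q : W b c) → IsPath (p ◅◅ q) → IsPath p
  IsPath-◅◅⁻ˡ p q pq = Unique-++⁻ˡ (vertices p) (subst Unique (vertices-◅◅ p q) pq)

  IsPath-◅◅⁻ʳ : (p : W a b) (q : W b c) → IsPath (p ◅◅ q) → IsPath q
  IsPath-◅◅⁻ʳ p q pq = Unique-∷ (λ b∈q → Unique-++⁻-disjoint (vertices p) pq′ (end∈vertices p , b∈q))
                                (Unique-++⁻ʳ (vertices p) pq′)
    where pq′ = subst Unique (vertices-◅◅ p q) pq

  IsPath-◅◅-meet : (p : W a b) (q : W b c) → IsPath (p ◅◅ q) → v ∈ vertices p → v ∈ vertices q → v ≡ b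
  IsPath-◅◅-meet p q pq v∈p (here refl) = refl
  IsPath-◅◅-meet p q pq v∈p (there v∈q) =
    ⊥-elim (Unique-++⁻-disjoint (vertices p) (subst Unique (vertices-◅◅ p q) pq) (v∈p , v∈q))

  IsPath-◅◅⁺ : (p : W a b) (q : W b c) → IsPath p → IsPath q →
               (∀ {v} → v ∈ vertices p → v ∈ vertices q → v ≡ b) → IsPath (p ◅◅ q)
  IsPath-◅◅⁺ p q pp (b∉q ∷ qq) meet = subst Unique (sym (vertices-◅◅ p q)) (Uniqueₚ.++⁺ pp qq disjoint)
    where
    disjoint : Disjoint (vertices p) (targets q)
    disjoint (v∈p , v∈q) = All.lookup b∉q (subst (_∈ _) (meet v∈p (there v∈q)) v∈q) refl

  IsCycle-◅◅⁺ : (p : W a b) (q : W b a) → IsPath p → IsPath q →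
                (∀ {v} → v ∈ vertices p → v ∈ vertices q → v ≡ a ⊎ v ≡ b) → IsCycle (p ◅◅ q)
  IsCycle-◅◅⁺ p q (a∉p ∷ pp) (b∉q ∷ qq) meet =
    subst Unique (sym (targets-◅◅ p q)) (Uniqueₚ.++⁺ pp qq disjoint)
    where
    disjoint : Disjoint (targets p) (targets q)
    disjoint {v} (v∈p , v∈q) with meet (there v∈p) (there v∈q)
    ... | inj₁ refl = All.lookup a∉p v∈p refl
    ... | inj₂ refl = All.lookup b∉q v∈q refl

  IsPath-◅◅³ : (p : W a b) (q : W b c) (r : W c d) → IsPath p → IsPath q → IsPath r →
               (∀ {v} → v ∈ vertices p → v ∈ vertices q → v ≡ b) →
               (∀ {v} → v ∈ vertices q → v ∈ vertices r → v ≡ c) →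
               (∀ {v} → v ∈ vertices p → v ∈ vertices r → v ≡ b) → IsPath (p ◅◅ q ◅◅ r)
  IsPath-◅◅³ p q r p-path q-path r-path pq qr pr =
    IsPath-◅◅⁺ p (q ◅◅ r) p-path (IsPath-◅◅⁺ q r q-path r-path qr) λ v∈p v∈qr → [ pq v∈p , pr v∈p ]′ (∈-◅◅⁻ q r v∈qr)

  IsPath-replace : (A₁ : W a b) (B : W b c) (A₂ : W c d) → IsPath (A₁ ◅◅ B ◅◅ A₂) →
                   (S : W b c) → IsPath S →
                   (∀ {v} → v ∈ vertices S → v ∈ vertices (A₁ ◅◅ B ◅◅ A₂) → v ≡ b ⊎ v ≡ c) →
                   IsPath (A₁ ◅◅ S ◅◅ A₂)
  IsPath-replace {b = b} {c = c} A₁ B A₂ path S S-path S∩path =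
    IsPath-◅◅³ A₁ S A₂
      (IsPath-◅◅⁻ˡ A₁ (B ◅◅ A₂) path) S-path (IsPath-◅◅⁻ʳ B A₂ (IsPath-◅◅⁻ʳ A₁ (B ◅◅ A₂) path))
      (λ v∈A₁ v∈S → meet-before v∈A₁ (ends-after (S∩path v∈S (∈-◅◅⁺ˡ A₁ (B ◅◅ A₂) v∈A₁))))
      (λ v∈S v∈A₂ →
         meet-after (ends-before (S∩path v∈S (∈-◅◅⁺ʳ A₁ (B ◅◅ A₂) (∈-◅◅⁺ʳ B A₂ v∈A₂)))) v∈A₂)
      (λ v∈A₁ v∈A₂ → meet-before v∈A₁ (∈-◅◅⁺ʳ B A₂ v∈A₂))
    where
    meet-before : ∀ {v} → v ∈ vertices A₁ → v ∈ vertices (B ◅◅ A₂) → v ≡ b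
    meet-before = IsPath-◅◅-meet A₁ (B ◅◅ A₂) path
    meet-after : ∀ {v} → v ∈ vertices (A₁ ◅◅ B) → v ∈ vertices A₂ → v ≡ c
    meet-after = IsPath-◅◅-meet (A₁ ◅◅ B) A₂ (subst IsPath (sym (◅◅-assoc A₁ B A₂)) path)
    ends-after : ∀ {v} → v ≡ b ⊎ v ≡ c → v ∈ vertices (B ◅◅ A₂)
    ends-after (inj₁ refl) = here refl
    ends-after (inj₂ refl) = ∈-◅◅⁺ʳ B A₂ (here refl)
    ends-before : ∀ {v} → v ≡ b ⊎ v ≡ c → v ∈ vertices (A₁ ◅◅ B)
    ends-before (inj₁ refl) = ∈-◅◅⁺ʳ A₁ B (here refl)
    ends-before (inj₂ refl) = end∈vertices (A₁ ◅◅ B)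

  closedPath⇒length≡0 : (w : W a a) → IsPath w → length w ≡ 0
  closedPath⇒length≡0 ε       _          = refl
  closedPath⇒length≡0 (e ◅ w) (a∉w ∷ _) = ⊥-elim (All.lookup a∉w (end∈vertices w) refl)

  lookup-vertices-end : (w : W a b) → List.lookup (vertices w) (fromℕ (length w)) ≡ b
  lookup-vertices-end ε       = refl
  lookup-vertices-end (e ◅ w) = lookup-vertices-end w

  lookup-vertices-step : (w : W a b) (i : Fin (length w)) →
                         E (List.lookup (vertices w) (inject₁ i)) (List.lookup (vertices w) (suc i))
  lookup-vertices-step (e ◅ w) zero    = e
  lookup-vertices-step (e ◅ w) (suc i) = lookup-vertices-step w i

  walk-through : ∀ k (f : Fin (suc k) → V) → (∀ (i : Fin k) → E (f (inject₁ i)) (f (suc i))) →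
                 f zero ≡ a → f (fromℕ k) ≡ b → Σ (W a b) λ w → vertices w ≡ List.tabulate f
  walk-through zero    f step refl refl = ε , refl
  walk-through (suc k) f step refl f-end with walk-through k (λ i → f (suc i)) (λ i → step (suc i)) refl f-end
  ... | w , vertices-w = step zero ◅ w , cong (f zero ∷_) vertices-w

  0<length : a ≢ b → (w : W a b) → 0 < length w
  0<length a≢a ε       = ⊥-elim (a≢a refl)
  0<length _   (e ◅ w) = s≤s z≤n

  end∈targets : a ≢ b → (w : W a b) → b ∈ targets w
  end∈targets a≢a ε       = ⊥-elim (a≢a refl)
  end∈targets _   (e ◅ w) = end∈vertices w

  rotate : (C : W c c) → IsCycle C → u ∈ vertices C →
           Σ (W u u) λ C′ → IsCycle C′ × length C′ ≡ length C × vertices C′ ⊆ vertices C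
  rotate C isCycle u∈C with split C u∈C
  ... | p , q , refl =
        q ◅◅ p , isCycle′ , length-rotated , λ v∈ → [ ∈-◅◅⁺ʳ p q , ∈-◅◅⁺ˡ p q ]′ (∈-◅◅⁻ q p v∈)
    where
    isCycle′ : IsCycle (q ◅◅ p)
    isCycle′ = subst Unique (sym (targets-◅◅ q p))
                 (Unique-resp-↭ (++-comm (targets p) (targets q)) (subst Unique (targets-◅◅ p q) isCycle))
    length-rotated : length (q ◅◅ p) ≡ length (p ◅◅ q)
    length-rotated = trans (length-◅◅ q p) (trans (+-comm (length q) (length p)) (sym (length-◅◅ p q)))

  arcs : (C : W c c) → IsCycle C → u ∈ vertices C → u ≢ c →
         ∃₂ λ (p : W c u) (q : W u c) → p ◅◅ q ≡ C × IsPath p × IsPath q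
  arcs C isCycle u∈C u≢c with split C u∈C
  ... | p , q , refl = p , q , refl ,
        Unique-∷ (λ c∈p → disjoint (c∈p , end∈targets u≢c q)) (Unique-++⁻ˡ (targets p) isCycle′) ,
        Unique-∷ (λ u∈q → disjoint (end∈targets (λ c≡u → u≢c (sym c≡u)) p , u∈q))
                 (Unique-++⁻ʳ (targets p) isCycle′)
    where
    isCycle′ = subst Unique (targets-◅◅ p q) isCycle
    disjoint = Unique-++⁻-disjoint (targets p) isCycle′

  module _ (E-sym : Sym E E) where

    private
      rev : W a b → W b a
      rev = reverse E-sym

    vertices-revApp : (w : W b a) (w′ : W b c) → vertices (revApp E-sym w w′) ≡ vertices w ʳ++ targets w′
    vertices-revApp ε       w′ = refl
    vertices-revApp (e ◅ w) w′ = vertices-revApp w (E-sym e ◅ w′)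

    vertices-reverse : (w : W a b) → vertices (rev w) ≡ List.reverse (vertices w)
    vertices-reverse w = vertices-revApp w ε

    length-reverse : (w : W a b) → length (rev w) ≡ length w
    length-reverse w = suc-injective (trans (cong List.length (vertices-reverse w)) (List.length-reverse (vertices w)))

    IsPath-reverse : (w : W a b) → IsPath w → IsPath (rev w)
    IsPath-reverse w isPath =
      subst Unique (sym (vertices-reverse w)) (Unique-resp-↭ (↭-sym (↭-reverse (vertices w))) isPath)

    ∈-reverse⁻ : (w : W a b) → vertices (rev w) ⊆ vertices w
    ∈-reverse⁻ w {v} v∈ = Anyₚ.reverse⁻ (subst (v ∈_) (vertices-reverse w) v∈)

    oddCycle-arcs : (C : W c c) → IsCycle C → parityOf C ≡ 1ℙ → u ∈ vertices C → u ≢ c →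
                    ∃₂ λ (α β : W c u) → IsPath α × IsPath β × vertices α ⊆ vertices C × vertices β ⊆ vertices C ×
                                         parityOf α ≢ parityOf β
    oddCycle-arcs C isCycle odd u∈C u≢c with arcs C isCycle u∈C u≢c
    ... | p , q , refl , p-path , q-path =
          p , rev q , p-path , IsPath-reverse q q-path , ∈-◅◅⁺ˡ p q , (λ v∈ → ∈-◅◅⁺ʳ p q (∈-reverse⁻ q v∈)) ,
          λ p≡q → p+q≡1ℙ⇒p≢q (trans (sym (parityOf-◅◅ p q)) odd) (trans p≡q (cong parity (length-reverse q)))

  module _ {P : V → Set} (P? : Decidable P) where

    lastHit : (w : W a b) → Any P (vertices w) →
              ∃ λ u → ∃₂ λ (p : W a u) (q : W u b) → p ◅◅ q ≡ w × P u × (∀ {v} → v ∈ targets q → ¬ P v)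
    lastHit ε (here pa) = _ , ε , ε , refl , pa , λ ()
    lastHit (e ◅ w) P∈ with Any.any? P? (vertices w)
    ... | yes P∈w with lastHit w P∈w
    ...   | u , p , q , refl , pu , after = u , e ◅ p , q , refl , pu , after
    lastHit (e ◅ w) (here pa)   | no P∉w = _ , ε , e ◅ w , refl , pa , λ v∈ pv → P∉w (lose v∈ pv)
    lastHit (e ◅ w) (there P∈w) | no P∉w = ⊥-elim (P∉w P∈w)

    firstHit : (w : W a b) → Any P (vertices w) →
               ∃ λ u → ∃₂ λ (p : W a u) (q : W u b) → p ◅◅ q ≡ w × P u × (∀ {v} → v ∈ vertices p → P v → v ≡ u)
    firstHit {a} w P∈ with P? a
    ... | yes pa = a , ε , w , refl , pa , λ { (here refl) _ → refl }
    firstHit ε       (here pa)   | no ¬pa = ⊥-elim (¬pa pa)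
    firstHit (e ◅ w) (here pa)   | no ¬pa = ⊥-elim (¬pa pa)
    firstHit (e ◅ w) (there P∈w) | no ¬pa with firstHit w P∈w
    ... | u , p , q , refl , pu , before =
          u , e ◅ p , q , refl , pu , λ { (here refl) pv → ⊥-elim (¬pa pv) ; (there v∈) pv → before v∈ pv }

  record ABPath (A B : V → Set) : Set where
    field
      start end     : V
      walk          : W start end
      isPath        : IsPath walk
      start∈A       : A start
      end∈B         : B end
      meets-A-once  : ∀ {v} → v ∈ vertices walk → A v → v ≡ start
      meets-B-once  : ∀ {v} → v ∈ vertices walk → B v → v ≡ end

  OddCycle : Set
  OddCycle = ∃ λ c → Σ (W c c) λ C → IsCycle C × parityOf C ≡ 1ℙ

  module _ (_≟_ : DecidableEquality V) where

    open import Data.List.Membership.DecPropositional _≟_ using (_∈?_)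

    erase : (w : W a b) → Σ (W a b) λ p → IsPath p × vertices p ⊆ vertices w
    erase ε = ε , Unique-∷ (λ ()) [] , λ v∈ → v∈
    erase {a} (e ◅ w) with erase w
    ... | p , isPath , p⊆w with a ∈? vertices p
    ...   | no a∉p = e ◅ p , Unique-∷ a∉p isPath , λ { (here refl) → here refl ; (there v∈) → there (p⊆w v∈) }
    ...   | yes a∈p with split p a∈p
    ...     | p₁ , p₂ , refl = p₂ , IsPath-◅◅⁻ʳ p₁ p₂ isPath , λ v∈ → there (p⊆w (∈-◅◅⁺ʳ p₁ p₂ v∈))

    position : W a b → V → ℕ
    position ε u = 0
    position {a} (e ◅ w) u with u ≟ a
    ... | yes _ = 0
    ... | no  _ = suc (position w u)

    position-◅◅ : (p : W a u) (q : W u b) → IsPath (p ◅◅ q) → position (p ◅◅ q) u ≡ length p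
    position-◅◅ ε ε _ = refl
    position-◅◅ {u = u} ε (e ◅ q) _ with u ≟ u
    ... | yes _  = refl
    ... | no u≢u = ⊥-elim (u≢u refl)
    position-◅◅ {a} {u} (e ◅ p) q (a∉pq ∷ isPath) with u ≟ a
    ... | yes refl = ⊥-elim (All.lookup a∉pq (∈-◅◅⁺ʳ p q (here refl)) refl)
    ... | no  _    = cong suc (position-◅◅ p q isPath)

    abPath : ∀ {A B : V → Set} → Decidable A → Decidable B → (w : W a b) → A a → B b →
             Σ (ABPath A B) λ π → vertices (ABPath.walk π) ⊆ vertices w
    abPath A? B? w a∈A b∈B with erase w
    ... | w′ , isPath , w′⊆w with lastHit A? w′ (here a∈A)
    ... | u , p , q , refl , u∈A , after with firstHit B? q (lose (end∈vertices q) b∈B)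
    ... | s , q₁ , q₂ , refl , s∈B , before = record
          { start = u ; end = s ; walk = q₁
          ; isPath = IsPath-◅◅⁻ˡ q₁ q₂ (IsPath-◅◅⁻ʳ p (q₁ ◅◅ q₂) isPath)
          ; start∈A = u∈A ; end∈B = s∈B
          ; meets-A-once = λ { (here refl) _ → refl
                             ; (there v∈) v∈A → ⊥-elim (after (targets-◅◅⁺ˡ q₁ q₂ v∈) v∈A) }
          ; meets-B-once = before
          } , λ v∈ → w′⊆w (∈-◅◅⁺ʳ p (q₁ ◅◅ q₂) (∈-◅◅⁺ˡ q₁ q₂ v∈))

    oddCycle-or-path : (w : W a b) → OddCycle ⊎ Σ (W a b) λ p → IsPath p × parityOf p ≡ parityOf w
    oddCycle-or-path ε = inj₂ (ε , Unique-∷ (λ ()) [] , refl)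
    oddCycle-or-path {a} (e ◅ w) with oddCycle-or-path w
    ... | inj₁ C = inj₁ C
    ... | inj₂ (p , isPath , p≡w) with a ∈? vertices p
    ...   | no a∉p = inj₂ (e ◅ p , Unique-∷ a∉p isPath ,
                          trans (parityOf-◅ e p) (trans (cong (1ℙ ℙ.+_) p≡w) (sym (parityOf-◅ e w))))
    ...   | yes a∈p with split p a∈p
    ...     | p₁ , p₂ , refl with parityOf (e ◅ p₁) in odd
    ...       | 1ℙ = inj₁ (a , e ◅ p₁ , IsPath-◅◅⁻ˡ p₁ p₂ isPath , odd)
    ...       | 0ℙ = inj₂ (p₂ , IsPath-◅◅⁻ʳ p₁ p₂ isPath , same)
      where
      open ≡-Reasoning
      same : parityOf p₂ ≡ parityOf (e ◅ w)
      same = begin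
        parityOf p₂                            ≡⟨ cong (ℙ._+ parityOf p₂) odd ⟨
        parityOf (e ◅ p₁) ℙ.+ parityOf p₂     ≡⟨ cong (ℙ._+ parityOf p₂) (parityOf-◅ e p₁) ⟩
        1ℙ ℙ.+ parityOf p₁ ℙ.+ parityOf p₂    ≡⟨ ℙ.+-assoc 1ℙ (parityOf p₁) (parityOf p₂) ⟩
        1ℙ ℙ.+ (parityOf p₁ ℙ.+ parityOf p₂)  ≡⟨ cong (1ℙ ℙ.+_) (parityOf-◅◅ p₁ p₂) ⟨
        1ℙ ℙ.+ parityOf (p₁ ◅◅ p₂)            ≡⟨ cong (1ℙ ℙ.+_) p≡w ⟩
        1ℙ ℙ.+ parityOf w                      ≡⟨ parityOf-◅ e w ⟨
        parityOf (e ◅ w)                       ∎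

open Walks

isOdd : Parity → Bool
isOdd 0ℙ = false
isOdd 1ℙ = true

isOdd-injective : ∀ {p q} → isOdd p ≡ isOdd q → p ≡ q
isOdd-injective {0ℙ} {0ℙ} _ = refl
isOdd-injective {1ℙ} {1ℙ} _ = refl

module _ {n : ℕ} (K : SimpleGraph n) where

  walk⇒Path : ∀ {a b} (w : Star (Adj K) a b) → IsPath w → Path K a b (length w)
  walk⇒Path w isPath = record
    { vtx   = List.lookup (vertices w)
    ; inj   = Unique-lookup-injective isPath
    ; start = refl
    ; end   = lookup-vertices-end w
    ; step  = lookup-vertices-step w
    }

  Path⇒walk : ∀ {a b k} (p : Path K a b k) → Σ (Star (Adj K) a b) λ w → vertices w ⊆ List.tabulate (vtx p)
  Path⇒walk {k = k} p with walk-through k (vtx p) (step p) (start p) (end p)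
  ... | w , vertices-w = w , λ {v} v∈ → subst (v ∈_) vertices-w v∈

  odd-closedWalk-other-vertex : ∀ {c} (C : Star (Adj K) c c) → parityOf C ≡ 1ℙ → ∃ λ b → b ∈ vertices C × b ≢ c
  odd-closedWalk-other-vertex (_◅_ {j = b} e C) _ = b , there (here refl) , λ { refl → adj-irrefl K e }

  monochromatic-edge : ¬ Bipartite K → (colour : Fin n → Bool) → ∃₂ λ u v → Adj K u v × colour u ≡ colour v
  monochromatic-edge ¬bipartite colour with any? (λ u → any? (λ v → dec K u v ×-dec (colour u Bool.≟ colour v)))
  ... | yes (u , v , e , same) = u , v , e , same
  ... | no none = ⊥-elim (¬bipartite (colour , λ u v e same → none (u , v , e , same)))

  oddCycle-of-nonBipartite : ∀ {x} → ¬ Bipartite K → (∀ v → Star (Adj K) x v) → OddCycle {E = Adj K}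
  oddCycle-of-nonBipartite ¬bipartite reach = via (monochromatic-edge ¬bipartite (λ v → isOdd (parityOf (reach v))))
    where
    via : (∃₂ λ u v → Adj K u v × isOdd (parityOf (reach u)) ≡ isOdd (parityOf (reach v))) → OddCycle
    via (u , v , e , same-colour) with oddCycle-or-path _≟_ (reach u ◅◅ e ◅ reverse (adj-sym K) (reach v))
    ... | inj₁ C = C
    ... | inj₂ (p , p-path , same-parity) =
          ⊥-elim (ℙ.p≢p⁻¹ 0ℙ (trans (cong parity (sym (closedPath⇒length≡0 p p-path))) (trans same-parity odd)))
      where
      open ≡-Reasoning
      pv = parityOf (reach v)
      odd : parityOf (reach u ◅◅ e ◅ reverse (adj-sym K) (reach v)) ≡ 1ℙ
      odd = begin
        parityOf (reach u ◅◅ e ◅ reverse (adj-sym K) (reach v))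
          ≡⟨ parityOf-◅◅ (reach u) _ ⟩
        parityOf (reach u) ℙ.+ parityOf (e ◅ reverse (adj-sym K) (reach v))
          ≡⟨ cong₂ ℙ._+_ (isOdd-injective same-colour) (parityOf-◅ e (reverse (adj-sym K) (reach v))) ⟩
        pv ℙ.+ (1ℙ ℙ.+ parityOf (reverse (adj-sym K) (reach v)))
          ≡⟨ cong (λ p → pv ℙ.+ (1ℙ ℙ.+ parity p)) (length-reverse (adj-sym K) (reach v)) ⟩
        pv ℙ.+ (1ℙ ℙ.+ pv)
          ≡⟨ cong (pv ℙ.+_) (ℙ.+-comm 1ℙ pv) ⟩
        pv ℙ.+ (pv ℙ.+ 1ℙ)
          ≡⟨ p+[p+q]≡q pv 1ℙ ⟩
        1ℙ ∎

module _ {n : ℕ} (G : SimpleGraph n) {x y : Fin n} (x≢y : x ≢ y) where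

  walk-+edge⁻ : ∀ {a b} (w : Star (Adj (G +edge ((x , y) , x≢y))) a b) → ¬ (x ∈ vertices w × y ∈ vertices w) →
                Σ (Star (Adj G) a b) λ w′ → vertices w′ ≡ vertices w
  walk-+edge⁻ ε _ = ε , refl
  walk-+edge⁻ {a} (inj₁ e ◅ w) ¬xy with walk-+edge⁻ w (λ (x∈ , y∈) → ¬xy (there x∈ , there y∈))
  ... | w′ , same = e ◅ w′ , cong (a ∷_) same
  walk-+edge⁻ (inj₂ (inj₁ (refl , refl)) ◅ w) ¬xy = ⊥-elim (¬xy (here refl , there (here refl)))
  walk-+edge⁻ (inj₂ (inj₂ (refl , refl)) ◅ w) ¬xy = ⊥-elim (¬xy (there (here refl) , here refl))

parity-even : ∀ q → parity (q * 2) ≡ 0ℙ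
parity-even zero    = refl
parity-even (suc q) = parity-even q

parity≡0ℙ⇒2∣ : ∀ k → parity k ≡ 0ℙ → 2 ∣ k
parity≡0ℙ⇒2∣ zero          _    = divides 0 refl
parity≡0ℙ⇒2∣ (suc (suc k)) even with divides q refl ← parity≡0ℙ⇒2∣ k even = divides (suc q) refl

parity≡1ℙ⇒2∤ : ∀ k → parity k ≡ 1ℙ → ¬ 2 ∣ k
parity≡1ℙ⇒2∤ k odd (divides q refl) with () ← trans (sym (parity-even q)) odd

paths-of-both-parities : ∀ {n} (K : SimpleGraph n) {a b} (P P′ : Star (Adj K) a b) → IsPath P → IsPath P′ →
  parityOf P ≢ parityOf P′ → (∃ λ k → ¬ (2 ∣ k) × Path K a b k) × (∃ λ k → 2 ∣ k × Path K a b k)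
paths-of-both-parities K P P′ P-path P′-path differ with parityOf P in p | parityOf P′ in p′
... | 0ℙ | 0ℙ = ⊥-elim (differ refl)
... | 1ℙ | 1ℙ = ⊥-elim (differ refl)
... | 0ℙ | 1ℙ = (length P′ , parity≡1ℙ⇒2∤ _ p′ , walk⇒Path K P′ P′-path)
              , (length P  , parity≡0ℙ⇒2∣ _ p  , walk⇒Path K P P-path)
... | 1ℙ | 0ℙ = (length P  , parity≡1ℙ⇒2∤ _ p  , walk⇒Path K P P-path)
              , (length P′ , parity≡0ℙ⇒2∣ _ p′ , walk⇒Path K P′ P′-path)

third-vertex : ∀ {n} → 3 ≤ n → (x y : Fin n) → ∃ λ z → z ≢ x × z ≢ y
third-vertex (s≤s (s≤s (s≤s _))) = pick
  where
  pick : ∀ {m} (x y : Fin (3 + m)) → ∃ λ z → z ≢ x × z ≢ y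
  pick zero          zero          = suc zero       , (λ ()) , (λ ())
  pick zero          (suc zero)    = suc (suc zero) , (λ ()) , (λ ())
  pick zero          (suc (suc _)) = suc zero       , (λ ()) , (λ ())
  pick (suc zero)    zero          = suc (suc zero) , (λ ()) , (λ ())
  pick (suc zero)    (suc _)       = zero           , (λ ()) , (λ ())
  pick (suc (suc _)) zero          = suc zero       , (λ ()) , (λ ())
  pick (suc (suc _)) (suc _)       = zero           , (λ ()) , (λ ())

module TwoConnectedWithEdge {n : ℕ} (G : SimpleGraph n) {x y : Fin n} (x≢y : x ≢ y)
  (no-cut-vertex : ∀ v → ConnectedWithout (G +edge ((x , y) , x≢y)) v) where

  private
    V = Fin n
    WG = Star (Adj G)
    H = G +edge ((x , y) , x≢y)
    rev : ∀ {a b} → WG a b → WG b a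
    rev = reverse (adj-sym G)
    variable
      a b c q r s : V

  open import Data.List.Membership.DecPropositional (_≟_ {n}) using (_∈?_)

  walk-avoiding : ∀ c → a ≢ c → b ≢ c → Σ (Star (Adj H) a b) λ w → c ∉ vertices w
  walk-avoiding {a} {b} c a≢c b≢c with no-cut-vertex c a b a≢c b≢c
  ... | _ , p , p-avoids-c with Path⇒walk H p
  ... | w , w⊆p = w , λ c∈w → let i , c≡pᵢ = ∈-tabulate⁻ {f = vtx p} (w⊆p c∈w) in p-avoids-c i (sym c≡pᵢ)

  -- Containing both x and y, the set B is met only once by an A–B path, which therefore never uses the edge xy.
  ABPath-avoiding : ∀ {A B : V → Set} → Decidable A → Decidable B → B x → B y → A a → B b → a ≢ c → b ≢ c →
                    Σ (ABPath {E = Adj G} A B) λ π → c ∉ vertices (ABPath.walk π)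
  ABPath-avoiding {c = c} A? B? Bx By Aa Bb a≢c b≢c with walk-avoiding c a≢c b≢c
  ... | w , c∉w with abPath _≟_ A? B? w Aa Bb
  ... | π , π⊆w
    with walk-+edge⁻ G x≢y (ABPath.walk π) (λ (x∈ , y∈) → x≢y (trans (meets-B-once x∈ Bx) (sym (meets-B-once y∈ By))))
    where open ABPath π using (meets-B-once)
  ... | walk′ , same = record
        { start = ABPath.start π ; end = ABPath.end π ; walk = walk′
        ; isPath = subst Unique (sym same) (ABPath.isPath π)
        ; start∈A = ABPath.start∈A π ; end∈B = ABPath.end∈B π
        ; meets-A-once = λ {v} v∈ → ABPath.meets-A-once π (subst (v ∈_) same v∈)
        ; meets-B-once = λ {v} v∈ → ABPath.meets-B-once π (subst (v ∈_) same v∈)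
        } , λ c∈ → c∉w (π⊆w (subst (c ∈_) same c∈))

  walk-avoiding-in-G : ∀ c → a ≢ c → b ≢ c → c ≡ x ⊎ c ≡ y → WG a b
  walk-avoiding-in-G c a≢c b≢c c-end with walk-avoiding c a≢c b≢c
  ... | w , c∉w =
        proj₁ (walk-+edge⁻ G x≢y w (λ (x∈ , y∈) → c∉w ([ (λ { refl → x∈ }) , (λ { refl → y∈ }) ]′ c-end)))

  path-from-x-to-y : 3 ≤ n → Σ (WG x y) IsPath
  path-from-x-to-y 3≤n with third-vertex 3≤n x y
  ... | z , z≢x , z≢y
    with erase _≟_ (walk-avoiding-in-G y x≢y z≢y (inj₂ refl) ◅◅ rev (walk-avoiding-in-G x y≢x z≢x (inj₁ refl)))
    where y≢x = λ y≡x → x≢y (sym y≡x)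
  ... | R , R-path , _ = R , R-path

  walk-from-x : WG x y → ∀ v → WG x v
  walk-from-x R v with v ≟ y
  ... | yes refl = R
  ... | no  v≢y  = walk-avoiding-in-G y x≢y v≢y (inj₂ refl)

  module OppositeParity (R : WG x y) (R-path : IsPath R) where

    OppositePath : Set
    OppositePath = Σ (WG x y) λ P → IsPath P × parityOf P ≢ parityOf R

    φ : V → Parity
    φ v = parity (position _≟_ R v)

    Matched : WG a b → Set
    Matched {a} {b} S = parityOf S ≡ φ a ℙ.+ φ b

    Segment : V → V → Set
    Segment a b = Σ (WG x a) λ A₁ → Σ (WG a b) λ B → Σ (WG b y) λ A₂ → A₁ ◅◅ B ◅◅ A₂ ≡ R

    φ-at : (p : WG x b) (q : WG b y) → p ◅◅ q ≡ R → φ b ≡ parityOf p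
    φ-at {b} p q p◅◅q≡R = cong parity (trans (cong (λ w → position _≟_ w b) (sym p◅◅q≡R))
                                            (position-◅◅ _≟_ p q (subst IsPath (sym p◅◅q≡R) R-path)))

    Segment-parity : (A₁ : WG x a) (B : WG a b) (A₂ : WG b y) → A₁ ◅◅ B ◅◅ A₂ ≡ R → φ a ℙ.+ φ b ≡ parityOf B
    Segment-parity A₁ B A₂ eq = begin
      φ _ ℙ.+ φ _                                   ≡⟨ cong₂ ℙ._+_ (φ-at A₁ (B ◅◅ A₂) eq)
                                                                  (φ-at (A₁ ◅◅ B) A₂ (trans (◅◅-assoc A₁ B A₂) eq)) ⟩
      parityOf A₁ ℙ.+ parityOf (A₁ ◅◅ B)            ≡⟨ cong (parityOf A₁ ℙ.+_) (parityOf-◅◅ A₁ B) ⟩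
      parityOf A₁ ℙ.+ (parityOf A₁ ℙ.+ parityOf B)  ≡⟨ p+[p+q]≡q (parityOf A₁) (parityOf B) ⟩
      parityOf B                                    ∎
      where open ≡-Reasoning

    segment-order : a ∈ vertices R → b ∈ vertices R → Segment a b ⊎ Segment b a
    segment-order {b = b} a∈R b∈R with split R a∈R
    ... | A₁ , A₂ , A₁A₂≡R with ∈-◅◅⁻ A₁ A₂ (subst (λ w → b ∈ vertices w) (sym A₁A₂≡R) b∈R)
    ... | inj₂ b∈A₂ with split A₂ b∈A₂
    ...   | B , A₂′ , refl = inj₁ (A₁ , B , A₂′ , A₁A₂≡R)
    segment-order a∈R b∈R | A₁ , A₂ , A₁A₂≡R | inj₁ b∈A₁ with split A₁ b∈A₁
    ...   | A₁′ , B , refl = inj₂ (A₁′ , B , A₂ , trans (sym (◅◅-assoc A₁′ B A₂)) A₁A₂≡R)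

    Matched-◅◅ : (p : WG a b) (q : WG b c) → Matched p → Matched q → Matched (p ◅◅ q)
    Matched-◅◅ {a} {b} {c} p q p-matched q-matched = begin
      parityOf (p ◅◅ q)              ≡⟨ parityOf-◅◅ p q ⟩
      parityOf p ℙ.+ parityOf q      ≡⟨ cong₂ ℙ._+_ p-matched q-matched ⟩
      (φ a ℙ.+ φ b) ℙ.+ (φ b ℙ.+ φ c) ≡⟨ [p+q]+[q+r]≡p+r (φ a) (φ b) (φ c) ⟩
      φ a ℙ.+ φ c                    ∎
      where open ≡-Reasoning

    Matched-reverse : (S : WG a b) → Matched (rev S) → Matched S
    Matched-reverse {a} {b} S matched =
      trans (cong parity (sym (length-reverse (adj-sym G) S))) (trans matched (ℙ.+-comm (φ b) (φ a)))

    closedPath-Matched : (S : WG a a) → IsPath S → Matched S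
    closedPath-Matched {a} S S-path = trans (cong parity (closedPath⇒length≡0 S S-path)) (sym (ℙ.p+p≡0ℙ (φ a)))

    segment-ear : (A₁ : WG x a) (B : WG a b) (A₂ : WG b y) → A₁ ◅◅ B ◅◅ A₂ ≡ R →
                  (S : WG a b) → IsPath S → (∀ {v} → v ∈ vertices S → v ∈ vertices R → v ≡ a ⊎ v ≡ b) →
                  OppositePath ⊎ Matched S
    segment-ear A₁ B A₂ eq S S-path S∩R with parityOf S ℙ.≟ parityOf B
    ... | yes same   = inj₂ (trans same (sym (Segment-parity A₁ B A₂ eq)))
    ... | no  differ = inj₁ (A₁ ◅◅ S ◅◅ A₂ , replaced-path , replaced-parity)
      where
      replaced-path : IsPath (A₁ ◅◅ S ◅◅ A₂)
      replaced-path = IsPath-replace A₁ B A₂ (subst IsPath (sym eq) R-path) S S-path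
                        λ {v} v∈S v∈ → S∩R v∈S (subst (λ w → v ∈ vertices w) eq v∈)
      replaced-parity : parityOf (A₁ ◅◅ S ◅◅ A₂) ≢ parityOf R
      replaced-parity same = p≢q⇒r+[p+s]≢r+[q+s] (parityOf A₁) (parityOf A₂) differ
        (trans (sym (parityOf-◅◅³ A₁ S A₂)) (trans same (trans (cong parityOf (sym eq)) (parityOf-◅◅³ A₁ B A₂))))

    ear-opposite-or-matched : (S : WG a b) → IsPath S → a ∈ vertices R → b ∈ vertices R →
                              (∀ {v} → v ∈ vertices S → v ∈ vertices R → v ≡ a ⊎ v ≡ b) → OppositePath ⊎ Matched S
    ear-opposite-or-matched S S-path a∈R b∈R S∩R with segment-order a∈R b∈R
    ... | inj₁ (A₁ , B , A₂ , eq) = segment-ear A₁ B A₂ eq S S-path S∩R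
    ... | inj₂ (A₁ , B , A₂ , eq) = map₂ (Matched-reverse S)
          (segment-ear A₁ B A₂ eq (rev S) (IsPath-reverse (adj-sym G) S S-path)
            λ v∈ v∈R → swap (S∩R (∈-reverse⁻ (adj-sym G) S v∈) v∈R))

    opposite-or-matched-after : (P : WG a b) (S : WG b c) → IsPath (P ◅◅ S) → a ∈ vertices R → c ∈ vertices R →
                                (∀ {v} → v ∈ vertices P → v ∈ vertices R → v ≡ a) → OppositePath ⊎ Matched (P ◅◅ S)
    opposite-or-matched-after P ε PS-path a∈R c∈R P∩R with P∩R (end∈vertices P) c∈R
    ... | refl = inj₂ (closedPath-Matched (P ◅◅ ε) PS-path)
    opposite-or-matched-after {a} {c = c} P (_◅_ {j = b′} e S) PS-path a∈R c∈R P∩R =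
      subst (λ w → OppositePath ⊎ Matched w) (◅◅-assoc P (e ◅ ε) S) (continue (b′ ∈? vertices R))
      where
      P′ = P ◅◅ (e ◅ ε)
      P′S-path : IsPath (P′ ◅◅ S)
      P′S-path = subst IsPath (sym (◅◅-assoc P (e ◅ ε) S)) PS-path
      P′∩R : ∀ {v} → v ∈ vertices P′ → v ∈ vertices R → v ≡ a ⊎ v ≡ b′
      P′∩R v∈P′ v∈R with ∈-◅◅⁻ P (e ◅ ε) v∈P′
      ... | inj₁ v∈P                = inj₁ (P∩R v∈P v∈R)
      ... | inj₂ (here refl)        = inj₁ (P∩R (end∈vertices P) v∈R)
      ... | inj₂ (there (here refl)) = inj₂ refl
      continue : Dec (b′ ∈ vertices R) → OppositePath ⊎ Matched (P′ ◅◅ S)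
      continue (no b′∉R) = opposite-or-matched-after P′ S P′S-path a∈R c∈R λ v∈P′ v∈R →
        [ (λ v≡a → v≡a) , (λ { refl → ⊥-elim (b′∉R v∈R) }) ]′ (P′∩R v∈P′ v∈R)
      continue (yes b′∈R) with ear-opposite-or-matched P′ (IsPath-◅◅⁻ˡ P′ S P′S-path) a∈R b′∈R P′∩R
      ... | inj₁ opposite = inj₁ opposite
      ... | inj₂ P′-matched
        with opposite-or-matched-after ε S (IsPath-◅◅⁻ʳ P′ S P′S-path) b′∈R c∈R (λ { (here refl) _ → refl })
      ...   | inj₁ opposite  = inj₁ opposite
      ...   | inj₂ S-matched = inj₂ (Matched-◅◅ P′ S P′-matched S-matched)

    opposite-or-matched : (S : WG a b) → IsPath S → a ∈ vertices R → b ∈ vertices R → OppositePath ⊎ Matched S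
    opposite-or-matched S S-path a∈R b∈R = opposite-or-matched-after ε S S-path a∈R b∈R (λ { (here refl) _ → refl })

    opposite-of-parity-mismatch : (S S′ : WG a b) → IsPath S → IsPath S′ → a ∈ vertices R → b ∈ vertices R →
                                  parityOf S ≢ parityOf S′ → OppositePath
    opposite-of-parity-mismatch S S′ S-path S′-path a∈R b∈R differ
      with opposite-or-matched S S-path a∈R b∈R | opposite-or-matched S′ S′-path a∈R b∈R
    ... | inj₁ opposite  | _               = opposite
    ... | inj₂ _         | inj₁ opposite   = opposite
    ... | inj₂ S-matched | inj₂ S′-matched = ⊥-elim (differ (trans S-matched (sym S′-matched)))

    record AttachedOddCycle (c r : V) : Set where
      field
        cycle       : WG c c
        isCycle     : IsCycle cycle
        odd         : parityOf cycle ≡ 1ℙ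
        tail        : WG c r
        tail-isPath : IsPath tail
        r∈R         : r ∈ vertices R
        tail∩cycle  : ∀ {v} → v ∈ vertices tail → v ∈ vertices cycle → v ≡ c

    open AttachedOddCycle

    opposite-via-arcs : (T : WG c r) (α β : WG c q) (Q : WG q s) → IsPath T → IsPath α → IsPath β → IsPath Q →
                        r ∈ vertices R → s ∈ vertices R →
                        (∀ {v} → v ∈ vertices T → v ∈ vertices α ⊎ v ∈ vertices β → v ≡ c) →
                        (∀ {v} → v ∈ vertices α ⊎ v ∈ vertices β → v ∈ vertices Q → v ≡ q) →
                        (∀ {v} → v ∈ vertices T → v ∉ vertices Q) →
                        parityOf α ≢ parityOf β → OppositePath
    opposite-via-arcs {c} {q = q} T α β Q T-path α-path β-path Q-path r∈R s∈R T∩arcs arcs∩Q T∩Q differ =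
      opposite-of-parity-mismatch (rev T ◅◅ α ◅◅ Q) (rev T ◅◅ β ◅◅ Q) (through α α-path inj₁) (through β β-path inj₂)
        r∈R s∈R λ same → p≢q⇒r+[p+s]≢r+[q+s] (parityOf (rev T)) (parityOf Q) differ
          (trans (sym (parityOf-◅◅³ (rev T) α Q)) (trans same (parityOf-◅◅³ (rev T) β Q)))
      where
      through : (γ : WG c q) → IsPath γ → (∀ {v} → v ∈ vertices γ → v ∈ vertices α ⊎ v ∈ vertices β) →
                IsPath (rev T ◅◅ γ ◅◅ Q)
      through γ γ-path γ⊆ = IsPath-◅◅³ (rev T) γ Q (IsPath-reverse (adj-sym G) T T-path) γ-path Q-path
        (λ v∈T v∈γ → T∩arcs (∈-reverse⁻ (adj-sym G) T v∈T) (γ⊆ v∈γ))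
        (λ v∈γ v∈Q → arcs∩Q (γ⊆ v∈γ) v∈Q)
        (λ v∈T v∈Q → ⊥-elim (T∩Q (∈-reverse⁻ (adj-sym G) T v∈T) v∈Q))

    shorter-attachment : (T₁ : WG c s) (T₂ : WG s r) (γ : WG c q) (Q : WG q s) → s ≢ c →
                         IsPath (T₁ ◅◅ T₂) → IsPath γ → IsPath Q → r ∈ vertices R →
                         (∀ {v} → v ∈ vertices (T₁ ◅◅ T₂) → v ∈ vertices γ → v ≡ c) →
                         (∀ {v} → v ∈ vertices γ → v ∈ vertices Q → v ≡ q) →
                         (∀ {v} → v ∈ vertices (T₁ ◅◅ T₂) → v ∈ vertices Q → v ≡ s) →
                         parityOf Q ℙ.+ (parityOf γ ℙ.+ parityOf T₁) ≡ 1ℙ →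
                         Σ (AttachedOddCycle s r) λ A → length (tail A) < length (T₁ ◅◅ T₂)
    shorter-attachment {c} {s} T₁ T₂ γ Q s≢c T-path γ-path Q-path r∈R T∩γ γ∩Q T∩Q odd′ = record
      { cycle       = C′
      ; isCycle     = IsCycle-◅◅⁺ (rev Q) (rev γ ◅◅ T₁) (IsPath-reverse (adj-sym G) Q Q-path) γT₁-path
                        λ v∈Q v∈γT₁ →
                          [ (λ v∈γ → inj₂ (γ∩Q (∈-reverse⁻ (adj-sym G) γ v∈γ) (∈-reverse⁻ (adj-sym G) Q v∈Q)))
                          , (λ v∈T₁ → inj₁ (T∩Q (∈-◅◅⁺ˡ T₁ T₂ v∈T₁) (∈-reverse⁻ (adj-sym G) Q v∈Q)))
                          ]′ (∈-◅◅⁻ (rev γ) T₁ v∈γT₁)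
      ; odd         = trans (parityOf-◅◅³ (rev Q) (rev γ) T₁)
                        (trans (cong₂ (λ m k → parity m ℙ.+ (parity k ℙ.+ parityOf T₁))
                                      (length-reverse (adj-sym G) Q) (length-reverse (adj-sym G) γ)) odd′)
      ; tail        = T₂
      ; tail-isPath = IsPath-◅◅⁻ʳ T₁ T₂ T-path
      ; r∈R         = r∈R
      ; tail∩cycle  = T₂∩C′
      } , subst (length T₂ <_) (sym (length-◅◅ T₁ T₂))
                (m<n+m (length T₂) (0<length (λ c≡s → s≢c (sym c≡s)) T₁))
      where
      C′ = rev Q ◅◅ rev γ ◅◅ T₁
      γT₁-path : IsPath (rev γ ◅◅ T₁)
      γT₁-path = IsPath-◅◅⁺ (rev γ) T₁ (IsPath-reverse (adj-sym G) γ γ-path) (IsPath-◅◅⁻ˡ T₁ T₂ T-path)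
                   λ v∈γ v∈T₁ → T∩γ (∈-◅◅⁺ˡ T₁ T₂ v∈T₁) (∈-reverse⁻ (adj-sym G) γ v∈γ)
      T₂∩C′ : ∀ {v} → v ∈ vertices T₂ → v ∈ vertices C′ → v ≡ s
      T₂∩C′ v∈T₂ v∈C′ with ∈-◅◅⁻ (rev Q) (rev γ ◅◅ T₁) v∈C′
      ... | inj₁ v∈Q = T∩Q (∈-◅◅⁺ʳ T₁ T₂ v∈T₂) (∈-reverse⁻ (adj-sym G) Q v∈Q)
      ... | inj₂ v∈γT₁ with ∈-◅◅⁻ (rev γ) T₁ v∈γT₁
      ...   | inj₂ v∈T₁ = IsPath-◅◅-meet T₁ T₂ T-path v∈T₁ v∈T₂
      ...   | inj₁ v∈γ with T∩γ (∈-◅◅⁺ʳ T₁ T₂ v∈T₂) (∈-reverse⁻ (adj-sym G) γ v∈γ)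
      ...     | refl = IsPath-◅◅-meet T₁ T₂ T-path (here refl) v∈T₂

    R-vertex-other-than : ∀ c → ∃ λ t → t ∈ vertices R × t ≢ c
    R-vertex-other-than c with c ≟ x
    ... | yes refl = y , end∈vertices R , λ y≡x → x≢y (sym y≡x)
    ... | no  c≢x  = x , here refl , λ x≡c → c≢x (sym x≡c)

    attached-step : (A : AttachedOddCycle c r) →
                    OppositePath ⊎ ∃ λ s → Σ (AttachedOddCycle s r) λ A′ → length (tail A′) < length (tail A)
    attached-step {c} {r} record { cycle = C ; isCycle = C-cycle ; odd = C-odd ; tail = T ; tail-isPath = T-path
                                 ; r∈R = r∈R ; tail∩cycle = T∩C }
      with odd-closedWalk-other-vertex G C C-odd | R-vertex-other-than c
    ... | b₀ , b₀∈C , b₀≢c | t , t∈R , t≢c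
      with ABPath-avoiding (_∈? vertices C) (λ v → (v ∈? vertices R) ⊎-dec (v ∈? vertices T))
             (inj₁ (here refl)) (inj₁ (end∈vertices R)) b₀∈C (inj₁ t∈R) b₀≢c t≢c
    ... | record { start = q ; end = s ; walk = Q ; isPath = Q-path ; start∈A = q∈C ; end∈B = s∈R∪T
                 ; meets-A-once = Q∩C ; meets-B-once = Q∩R∪T } , c∉Q
      with oddCycle-arcs (adj-sym G) C C-cycle C-odd q∈C (avoids-c (here refl))
      where
      avoids-c : ∀ {v} → v ∈ vertices Q → v ≢ c
      avoids-c v∈Q refl = c∉Q v∈Q
    ... | α , β , α-path , β-path , α⊆C , β⊆C , differ with s ∈? vertices T
    ... | no s∉T = inj₁ (opposite-via-arcs T α β Q T-path α-path β-path Q-path r∈R s∈R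
                           (λ v∈T v∈arc → T∩C v∈T ([ α⊆C , β⊆C ]′ v∈arc))
                           (λ v∈arc v∈Q → Q∩C v∈Q ([ α⊆C , β⊆C ]′ v∈arc))
                           (λ v∈T v∈Q → s∉T (subst (_∈ vertices T) (Q∩R∪T v∈Q (inj₂ v∈T)) v∈T)) differ)
      where
      s∈R : s ∈ vertices R
      s∈R = [ (λ s∈R → s∈R) , (λ s∈T → ⊥-elim (s∉T s∈T)) ]′ s∈R∪T
    ... | yes s∈T with split T s∈T
    ...   | T₁ , T₂ , refl = inj₂ (s , [ via α α-path α⊆C , via β β-path β⊆C ]′
                                   (p≢q⇒p≡1ℙ⊎q≡1ℙ (p≢q⇒r+[p+s]≢r+[q+s] (parityOf Q) (parityOf T₁) differ)))
      where
      via : (γ : WG c q) → IsPath γ → vertices γ ⊆ vertices C → parityOf Q ℙ.+ (parityOf γ ℙ.+ parityOf T₁) ≡ 1ℙ →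
            Σ (AttachedOddCycle s r) λ A′ → length (tail A′) < length (T₁ ◅◅ T₂)
      via γ γ-path γ⊆C = shorter-attachment T₁ T₂ γ Q (λ { refl → c∉Q (end∈vertices Q) }) T-path γ-path Q-path r∈R
                           (λ v∈T v∈γ → T∩C v∈T (γ⊆C v∈γ)) (λ v∈γ v∈Q → Q∩C v∈Q (γ⊆C v∈γ))
                           (λ v∈T v∈Q → Q∩R∪T v∈Q (inj₂ v∈T))

    opposite-of-attached-acc : (A : AttachedOddCycle c r) → Acc _<_ (length (tail A)) → OppositePath
    opposite-of-attached-acc A (acc shorter) =
      [ (λ opposite → opposite) , (λ (_ , A′ , A′<A) → opposite-of-attached-acc A′ (shorter A′<A)) ]′ (attached-step A)

    opposite-of-attached : AttachedOddCycle c r → OppositePath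
    opposite-of-attached A = opposite-of-attached-acc A (<-wellFounded _)

    opposite-of-oddCycle : (C : WG c c) → IsCycle C → parityOf C ≡ 1ℙ → WG c x → OppositePath
    opposite-of-oddCycle C C-cycle C-odd w with abPath _≟_ (_∈? vertices C) (_∈? vertices R) w (here refl) (here refl)
    ... | record { start = q ; walk = T ; isPath = T-path ; start∈A = q∈C ; end∈B = r∈R ; meets-A-once = T∩C } , _
      with rotate C C-cycle q∈C
    ... | C′ , C′-cycle , same-length , C′⊆C = opposite-of-attached record
          { cycle       = C′
          ; isCycle     = C′-cycle
          ; odd         = trans (cong parity same-length) C-odd
          ; tail        = T
          ; tail-isPath = T-path
          ; r∈R         = r∈R
          ; tail∩cycle  = λ v∈T v∈C′ → T∩C v∈T (C′⊆C v∈C′)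
          }

  paths-of-different-parity : 3 ≤ n → ¬ Bipartite G →
                              ∃₂ λ (P P′ : WG x y) → IsPath P × IsPath P′ × parityOf P ≢ parityOf P′
  paths-of-different-parity 3≤n ¬bipartite =
    let R , R-path              = path-from-x-to-y 3≤n
        c , C , C-cycle , C-odd = oddCycle-of-nonBipartite G ¬bipartite (walk-from-x R)
        P , P-path , P≢R        = OppositeParity.opposite-of-oddCycle R R-path C C-cycle C-odd (rev (walk-from-x R c))
    in P , R , P-path , R-path , P≢R

proposition4p1 : ∀ {n : ℕ} (G : SimpleGraph n) (x y : Fin n) (x≢y : x ≢ y) →
    ¬ Bipartite G → TwoConnected (G +edge ((x , y) , x≢y)) →
    (∃ λ k → ¬ (2 ∣ k) × Path G x y k) × (∃ λ k → 2 ∣ k × Path G x y k)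
proposition4p1 G x y x≢y ¬bipartite (3≤n , _ , no-cut-vertex) =
  let P , P′ , P-path , P′-path , differ =
        TwoConnectedWithEdge.paths-of-different-parity G x≢y no-cut-vertex 3≤n ¬bipartite
  in paths-of-both-parities G P P′ P-path P′-path differ
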